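{- Let $f:\{0,1\}^n\to\{ -1,1\}$ satisfy $f(\vec1+x)=-f(x)$ for all $x$, and let $p$ be the acceptance probability of the Basic Test with oracle access to $f$. Then \[ p=\frac12+\frac12\sum_{\alpha\in\{0,1\}^n}\widehat f(\alpha)^3\,2^{ -|\alpha|}\Big(1+\sum_{\beta\subseteq\alpha}\widehat f(\beta)\Big). \]
   Context: Vectors lie in $\{0,1\}^n$ with coordinatewise addition mod $2$; $\wedge$ is coordinatewise AND; $\vec1$ is the all-ones vector; $|v|=\sum_iv_i$ and $v$ is identified with the subset $\{i:v_i=1\}$, so $\beta\subseteq\alpha$ means $\beta_i\le\alpha_i$ for all $i$. $\widehat f(\alpha)=\mathbb{E}_{x}f(x)(-1)^{\sum_i\alpha_ix_i}$ with $x$ uniform. Basic Test with oracle access to $f$: pick $x_i,x_j,y,z$ independently and uniformly from $\{0,1\}^n$; query $f(y)$; let $v=\frac{1-f(y)}{2}$; accept iff $f(x_i)f(x_j)=f\big(x_i+x_j+(v\vec1+y)\wedge z\big)$. -}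

module Defs where

open import Data.Bool using (Bool; true; false; not; _xor_; _∧_; if_then_else_)
open import Data.Nat as ℕ using (ℕ; zero; suc)
open import Data.Vec using (Vec; []; _∷_; zipWith; replicate; map)
open import Data.List as List using (List; []; _∷_; concatMap; filter)
open import Data.Rational using (ℚ; 0ℚ; 1ℚ; ½; _+_; _*_; -_)
open import Data.Rational.Properties using (_≟_)
open import Relation.Nullary using (does)
open import Relation.Unary using (Decidable)

BV : ℕ → Set
BV n = Vec Bool n

_⊕_ : ∀ {n} → BV n → BV n → BV n
_⊕_ = zipWith _xor_

_⊓_ : ∀ {n} → BV n → BV n → BV n
_⊓_ = zipWith _∧_

𝟏 : ∀ n → BV n
𝟏 n = replicate n true

scal : ∀ n → Bool → BV n
scal n v = replicate n v

weight : ∀ {n} → BV n → ℕ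
weight [] = 0
weight (true ∷ v) = suc (weight v)
weight (false ∷ v) = weight v

dotParity : ∀ {n} → BV n → BV n → Bool
dotParity [] [] = false
dotParity (a ∷ α) (x ∷ xs) = (a ∧ x) xor dotParity α xs

subsetB : ∀ {n} → BV n → BV n → Bool
subsetB [] [] = true
subsetB (true ∷ β) (false ∷ α) = false
subsetB (_ ∷ β) (_ ∷ α) = subsetB β α

allBV : ∀ n → List (BV n)
allBV zero = [] ∷ []
allBV (suc n) = concatMap (λ b → List.map (b ∷_) (allBV n)) (true ∷ false ∷ [])

sumL : ∀ {A : Set} → List A → (A → ℚ) → ℚ
sumL [] g = 0ℚ
sumL (a ∷ as) g = g a + sumL as g

_^ℚ_ : ℚ → ℕ → ℚ
q ^ℚ zero = 1ℚ
q ^ℚ suc k = q * (q ^ℚ k)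

𝔼 : ∀ n → (BV n → ℚ) → ℚ
𝔼 n g = (½ ^ℚ n) * sumL (allBV n) g

sgn : Bool → ℚ
sgn b = if b then - 1ℚ else 1ℚ

fhat : ∀ {n} → (BV n → ℚ) → BV n → ℚ
fhat {n} f α = 𝔼 n (λ x → f x * sgn (dotParity α x))

IsBoolean : ∀ {n} → (BV n → ℚ) → Set
IsBoolean {n} f = ∀ x → (f x ≡ 1ℚ) ⊎ (f x ≡ - 1ℚ)
  where open import Relation.Binary.PropositionalEquality using (_≡_)
        open import Data.Sum using (_⊎_)

indEq : ℚ → ℚ → ℚ
indEq a b = if does (a ≟ b) then 1ℚ else 0ℚ

-- the bit v = (1 - f(y))/2 : true iff f(y) = -1
vBit : ℚ → Bool
vBit fy = does (fy ≟ - 1ℚ)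

basicAccept : ∀ {n} → (BV n → ℚ) → BV n → BV n → BV n → BV n → ℚ
basicAccept {n} f xi xj y z =
  indEq (f xi * f xj) (f ((xi ⊕ xj) ⊕ ((scal n (vBit (f y)) ⊕ y) ⊓ z)))

basicTestAcc : ∀ {n} → (BV n → ℚ) → ℚ
basicTestAcc {n} f =
  𝔼 n (λ xi → 𝔼 n (λ xj → 𝔼 n (λ y → 𝔼 n (λ z → basicAccept f xi xj y z))))

subsetSum : ∀ {n} → (BV n → ℚ) → BV n → ℚ
subsetSum {n} f α = sumL (allBV n) (λ β → if subsetB β α then fhat f β else 0ℚ)

-- Write χ_α(x) = (-1)^⟨α,x⟩ and f = Σ_α f̂(α) χ_α (Fourier inversion).  For
-- values ±1 the acceptance indicator of  f(x_i) f(x_j) = f(t)  equals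
-- ½ + ½ f(x_i) f(x_j) f(t), and since χ_α is a character,
--   f(x_i) f(x_j) f(x_i + x_j + w) = Σ_α f̂(α) (f χ_α)(x_i) (f χ_α)(x_j) χ_α(w).
-- Taking expectations, the four variables separate: E[f χ_α] = f̂(α) twice, and
-- for the mask w = (v𝟏 + y) ∧ z:
--   * averaging over z, E_z χ_α(u ∧ z) is the indicator that α and u are disjoint;
--   * averaging that over u gives 2^{-|α|}, and averaging it against f gives
--     2^{-|α|} Σ_{β⊆α} f̂(β) (a subset-character sum);
--   * the shift v𝟏 with v = [f(y) = -1] is undone by the substitution y ↦ 𝟏 + y,
--     using the oddness f(𝟏 + y) = -f(y).
module Submission where

open import Defs
open import Data.Bool using (Bool; true; false; not; _xor_; _∧_; if_then_else_)
open import Data.Nat using (ℕ; zero; suc)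
open import Data.Vec using ([]; _∷_)
open import Data.List as List using (List; []; _∷_; _++_)
open import Data.Rational using (ℚ; 0ℚ; 1ℚ; ½; _+_; _*_; -_)
open import Data.Rational.Properties using (+-comm; +-identityˡ; *-comm)
open import Data.Rational.Solver using (module +-*-Solver)
open import Data.Bool.Properties using (not-involutive)
open import Data.Sum using (_⊎_; inj₁; inj₂)
open import Relation.Binary.PropositionalEquality
open +-*-Solver
open ≡-Reasoning


sum-cong : ∀ {A : Set} (as : List A) {g h : A → ℚ} → (∀ a → g a ≡ h a) → sumL as g ≡ sumL as h
sum-cong [] eq = refl
sum-cong (a ∷ as) eq = cong₂ _+_ (eq a) (sum-cong as eq)

sum-0 : ∀ {A : Set} (as : List A) → sumL as (λ _ → 0ℚ) ≡ 0ℚ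
sum-0 [] = refl
sum-0 (a ∷ as) = cong (0ℚ +_) (sum-0 as)

sum-+ : ∀ {A : Set} (as : List A) (g h : A → ℚ) → sumL as (λ a → g a + h a) ≡ sumL as g + sumL as h
sum-+ [] g h = refl
sum-+ (a ∷ as) g h = begin
  g a + h a + sumL as (λ a → g a + h a) ≡⟨ cong (g a + h a +_) (sum-+ as g h) ⟩
  g a + h a + (sumL as g + sumL as h)
    ≡⟨ solve 4 (λ p q r s → p :+ q :+ (r :+ s) := p :+ r :+ (q :+ s)) refl (g a) (h a) (sumL as g) (sumL as h) ⟩
  g a + sumL as g + (h a + sumL as h) ∎

sum-*ˡ : ∀ {A : Set} (as : List A) (c : ℚ) (g : A → ℚ) → sumL as (λ a → c * g a) ≡ c * sumL as g
sum-*ˡ [] c g = solve 1 (λ c → con 0ℚ := c :* con 0ℚ) refl c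
sum-*ˡ (a ∷ as) c g = begin
  c * g a + sumL as (λ a → c * g a) ≡⟨ cong (c * g a +_) (sum-*ˡ as c g) ⟩
  c * g a + c * sumL as g           ≡⟨ solve 3 (λ c p q → c :* p :+ c :* q := c :* (p :+ q)) refl c (g a) (sumL as g) ⟩
  c * (g a + sumL as g)             ∎

sum-swap : ∀ {A B : Set} (as : List A) (bs : List B) (g : A → B → ℚ)
  → sumL as (λ a → sumL bs (g a)) ≡ sumL bs (λ b → sumL as (λ a → g a b))
sum-swap [] bs g = sym (sum-0 bs)
sum-swap (a ∷ as) bs g = begin
  sumL bs (g a) + sumL as (λ a → sumL bs (g a))          ≡⟨ cong (sumL bs (g a) +_) (sum-swap as bs g) ⟩
  sumL bs (g a) + sumL bs (λ b → sumL as (λ a → g a b))  ≡⟨ sym (sum-+ bs (g a) _) ⟩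
  sumL bs (λ b → sumL (a ∷ as) (λ a → g a b))            ∎

sum-++ : ∀ {A : Set} (as bs : List A) (g : A → ℚ) → sumL (as ++ bs) g ≡ sumL as g + sumL bs g
sum-++ [] bs g = solve 1 (λ x → x := con 0ℚ :+ x) refl (sumL bs g)
sum-++ (a ∷ as) bs g = trans (cong (g a +_) (sum-++ as bs g))
  (solve 3 (λ p q r → p :+ (q :+ r) := p :+ q :+ r) refl (g a) (sumL as g) (sumL bs g))

sum-map : ∀ {A B : Set} (h : A → B) (as : List A) (g : B → ℚ) → sumL (List.map h as) g ≡ sumL as (λ a → g (h a))
sum-map h [] g = refl
sum-map h (a ∷ as) g = cong (g (h a) +_) (sum-map h as g)


sum-suc : ∀ n (g : BV (suc n) → ℚ) → sumL (allBV (suc n)) g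
  ≡ sumL (allBV n) (λ x → g (true ∷ x)) + sumL (allBV n) (λ x → g (false ∷ x))
sum-suc n g = begin
  sumL (trues ++ (falses ++ [])) g          ≡⟨ sum-++ trues _ g ⟩
  sumL trues g + sumL (falses ++ []) g      ≡⟨ cong (sumL trues g +_) (sum-++ falses [] g) ⟩
  sumL trues g + (sumL falses g + 0ℚ)       ≡⟨ cong (sumL trues g +_) (solve 1 (λ x → x :+ con 0ℚ := x) refl _) ⟩
  sumL trues g + sumL falses g              ≡⟨ cong₂ _+_ (sum-map (true ∷_) (allBV n) g) (sum-map (false ∷_) (allBV n) g) ⟩
  sumL (allBV n) (λ x → g (true ∷ x)) + sumL (allBV n) (λ x → g (false ∷ x)) ∎
  where
  trues = List.map (true ∷_) (allBV n)
  falses = List.map (false ∷_) (allBV n)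

sum-translate : ∀ n (t : BV n) (g : BV n → ℚ) → sumL (allBV n) (λ x → g (t ⊕ x)) ≡ sumL (allBV n) g
sum-translate zero [] g = refl
sum-translate (suc n) (true ∷ t) g = begin
  sumL (allBV (suc n)) (λ x → g ((true ∷ t) ⊕ x))  ≡⟨ sum-suc n _ ⟩
  sumL (allBV n) (λ x → g (false ∷ (t ⊕ x))) + sumL (allBV n) (λ x → g (true ∷ (t ⊕ x)))
    ≡⟨ cong₂ _+_ (sum-translate n t (λ x → g (false ∷ x))) (sum-translate n t (λ x → g (true ∷ x))) ⟩
  sumL (allBV n) (λ x → g (false ∷ x)) + sumL (allBV n) (λ x → g (true ∷ x))  ≡⟨ +-comm (sumL (allBV n) (λ x → g (false ∷ x))) _ ⟩
  sumL (allBV n) (λ x → g (true ∷ x)) + sumL (allBV n) (λ x → g (false ∷ x))  ≡⟨ sym (sum-suc n g) ⟩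
  sumL (allBV (suc n)) g ∎
sum-translate (suc n) (false ∷ t) g = begin
  sumL (allBV (suc n)) (λ x → g ((false ∷ t) ⊕ x))  ≡⟨ sum-suc n _ ⟩
  sumL (allBV n) (λ x → g (true ∷ (t ⊕ x))) + sumL (allBV n) (λ x → g (false ∷ (t ⊕ x)))
    ≡⟨ cong₂ _+_ (sum-translate n t (λ x → g (true ∷ x))) (sum-translate n t (λ x → g (false ∷ x))) ⟩
  sumL (allBV n) (λ x → g (true ∷ x)) + sumL (allBV n) (λ x → g (false ∷ x))  ≡⟨ sym (sum-suc n g) ⟩
  sumL (allBV (suc n)) g ∎


E-cong : ∀ n {g h : BV n → ℚ} → (∀ x → g x ≡ h x) → 𝔼 n g ≡ 𝔼 n h
E-cong n eq = cong (½ ^ℚ n *_) (sum-cong (allBV n) eq)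

E-suc : ∀ n (g : BV (suc n) → ℚ) → 𝔼 (suc n) g ≡ ½ * (𝔼 n (λ x → g (true ∷ x)) + 𝔼 n (λ x → g (false ∷ x)))
E-suc n g = trans (cong ((½ * (½ ^ℚ n)) *_) (sum-suc n g))
  (solve 3 (λ p a b → con ½ :* p :* (a :+ b) := con ½ :* (p :* a :+ p :* b)) refl (½ ^ℚ n) _ _)

E-+ : ∀ n (g h : BV n → ℚ) → 𝔼 n (λ x → g x + h x) ≡ 𝔼 n g + 𝔼 n h
E-+ n g h = trans (cong (½ ^ℚ n *_) (sum-+ (allBV n) g h))
  (solve 3 (λ p a b → p :* (a :+ b) := p :* a :+ p :* b) refl (½ ^ℚ n) _ _)

E-*ˡ : ∀ n (c : ℚ) (g : BV n → ℚ) → 𝔼 n (λ x → c * g x) ≡ c * 𝔼 n g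
E-*ˡ n c g = trans (cong (½ ^ℚ n *_) (sum-*ˡ (allBV n) c g))
  (solve 3 (λ p c a → p :* (c :* a) := c :* (p :* a)) refl (½ ^ℚ n) c _)

E-*ʳ : ∀ n (c : ℚ) (g : BV n → ℚ) → 𝔼 n (λ x → g x * c) ≡ 𝔼 n g * c
E-*ʳ n c g = begin
  𝔼 n (λ x → g x * c)  ≡⟨ E-cong n (λ x → *-comm (g x) c) ⟩
  𝔼 n (λ x → c * g x)  ≡⟨ E-*ˡ n c g ⟩
  c * 𝔼 n g            ≡⟨ *-comm c _ ⟩
  𝔼 n g * c            ∎

E-neg : ∀ n (g : BV n → ℚ) → 𝔼 n (λ x → - g x) ≡ - 𝔼 n g
E-neg n g = begin
  𝔼 n (λ x → - g x)       ≡⟨ E-cong n (λ x → solve 1 (λ a → :- a := (:- con 1ℚ) :* a) refl (g x)) ⟩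
  𝔼 n (λ x → - 1ℚ * g x)  ≡⟨ E-*ˡ n (- 1ℚ) g ⟩
  - 1ℚ * 𝔼 n g            ≡⟨ solve 1 (λ a → (:- con 1ℚ) :* a := :- a) refl _ ⟩
  - 𝔼 n g                 ∎

½-double : ∀ c → ½ * (c + c) ≡ c
½-double = solve 1 (λ c → con ½ :* (c :+ c) := c) refl

E-const : ∀ n (c : ℚ) → 𝔼 n (λ _ → c) ≡ c
E-const zero c = solve 1 (λ c → con 1ℚ :* (c :+ con 0ℚ) := c) refl c
E-const (suc n) c = trans (E-suc n (λ _ → c)) (trans (cong (λ e → ½ * (e + e)) (E-const n c)) (½-double c))

E-affine : ∀ n (g : BV n → ℚ) → 𝔼 n (λ x → ½ + ½ * g x) ≡ ½ + ½ * 𝔼 n g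
E-affine n g = trans (E-+ n (λ _ → ½) (λ x → ½ * g x)) (cong₂ _+_ (E-const n ½) (E-*ˡ n ½ g))

E-if : ∀ n (b : Bool) (g : BV n → ℚ) → (if b then 𝔼 n g else 0ℚ) ≡ 𝔼 n (λ x → if b then g x else 0ℚ)
E-if n true g = refl
E-if n false g = sym (E-const n 0ℚ)

E-sum : ∀ {A : Set} n (as : List A) (g : BV n → A → ℚ)
  → 𝔼 n (λ x → sumL as (g x)) ≡ sumL as (λ a → 𝔼 n (λ x → g x a))
E-sum n as g = begin
  ½ ^ℚ n * sumL (allBV n) (λ x → sumL as (g x))        ≡⟨ cong (½ ^ℚ n *_) (sum-swap (allBV n) as g) ⟩
  ½ ^ℚ n * sumL as (λ a → sumL (allBV n) (λ x → g x a)) ≡⟨ sym (sum-*ˡ as (½ ^ℚ n) _) ⟩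
  sumL as (λ a → 𝔼 n (λ x → g x a))                      ∎

E-translate : ∀ n (t : BV n) (g : BV n → ℚ) → 𝔼 n (λ x → g (t ⊕ x)) ≡ 𝔼 n g
E-translate n t g = cong (½ ^ℚ n *_) (sum-translate n t g)


𝔼⁴ : ∀ n → (BV n → BV n → BV n → BV n → ℚ) → ℚ
𝔼⁴ n g = 𝔼 n (λ a → 𝔼 n (λ b → 𝔼 n (λ c → 𝔼 n (λ d → g a b c d))))

𝔼⁴-cong : ∀ n {g h : BV n → BV n → BV n → BV n → ℚ}
  → (∀ a b c d → g a b c d ≡ h a b c d) → 𝔼⁴ n g ≡ 𝔼⁴ n h
𝔼⁴-cong n eq = E-cong n (λ a → E-cong n (λ b → E-cong n (λ c → E-cong n (eq a b c))))

𝔼⁴-affine : ∀ n (g : BV n → BV n → BV n → BV n → ℚ) → 𝔼⁴ n (λ a b c d → ½ + ½ * g a b c d) ≡ ½ + ½ * 𝔼⁴ n g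
𝔼⁴-affine n g =
  trans (E-cong n (λ a → E-cong n (λ b → E-cong n (λ c → E-affine n (g a b c)))))
  (trans (E-cong n (λ a → E-cong n (λ b → E-affine n _)))
  (trans (E-cong n (λ a → E-affine n _)) (E-affine n _)))

𝔼⁴-sum : ∀ {A : Set} n (as : List A) (g : A → BV n → BV n → BV n → BV n → ℚ)
  → 𝔼⁴ n (λ a b c d → sumL as (λ α → g α a b c d)) ≡ sumL as (λ α → 𝔼⁴ n (g α))
𝔼⁴-sum n as g =
  trans (E-cong n (λ a → E-cong n (λ b → E-cong n (λ c → E-sum n as (λ d α → g α a b c d)))))
  (trans (E-cong n (λ a → E-cong n (λ b → E-sum n as _)))
  (trans (E-cong n (λ a → E-sum n as _)) (E-sum n as _)))

𝔼⁴-product : ∀ n (k : ℚ) (g h : BV n → ℚ) (m : BV n → BV n → ℚ)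
  → 𝔼⁴ n (λ a b c d → k * g a * h b * m c d) ≡ k * 𝔼 n g * 𝔼 n h * 𝔼 n (λ c → 𝔼 n (m c))
𝔼⁴-product n k g h m = begin
  𝔼⁴ n (λ a b c d → k * g a * h b * m c d)
    ≡⟨ E-cong n (λ a → E-cong n (λ b → E-cong n (λ c → E-*ˡ n (k * g a * h b) (m c)))) ⟩
  𝔼 n (λ a → 𝔼 n (λ b → 𝔼 n (λ c → k * g a * h b * 𝔼 n (m c))))
    ≡⟨ E-cong n (λ a → E-cong n (λ b → E-*ˡ n (k * g a * h b) (λ c → 𝔼 n (m c)))) ⟩
  𝔼 n (λ a → 𝔼 n (λ b → k * g a * h b * M))
    ≡⟨ E-cong n (λ a → trans (E-*ʳ n M (λ b → k * g a * h b)) (cong (_* M) (E-*ˡ n (k * g a) h))) ⟩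
  𝔼 n (λ a → k * g a * 𝔼 n h * M)
    ≡⟨ trans (E-*ʳ n M _) (cong (_* M) (trans (E-*ʳ n (𝔼 n h) _) (cong (_* 𝔼 n h) (E-*ˡ n k g)))) ⟩
  k * 𝔼 n g * 𝔼 n h * M ∎
  where M = 𝔼 n (λ c → 𝔼 n (m c))


χ : ∀ {n} → BV n → BV n → ℚ
χ α x = sgn (dotParity α x)

sgn-xor : ∀ a b → sgn (a xor b) ≡ sgn a * sgn b
sgn-xor true true = refl
sgn-xor true false = refl
sgn-xor false true = refl
sgn-xor false false = refl

sgn-not : ∀ a → sgn (not a) ≡ - sgn a
sgn-not true = refl
sgn-not false = refl

χ-cons : ∀ {n} a c (α x : BV n) → χ (a ∷ α) (c ∷ x) ≡ sgn (a ∧ c) * χ α x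
χ-cons a c α x = sgn-xor (a ∧ c) (dotParity α x)

χ-⊕ : ∀ {n} (α x y : BV n) → χ α (x ⊕ y) ≡ χ α x * χ α y
χ-⊕ [] [] [] = refl
χ-⊕ (a ∷ α) (b ∷ x) (c ∷ y) = begin
  χ (a ∷ α) ((b xor c) ∷ (x ⊕ y))              ≡⟨ χ-cons a (b xor c) α (x ⊕ y) ⟩
  sgn (a ∧ (b xor c)) * χ α (x ⊕ y)            ≡⟨ cong₂ _*_ (coordinate a) (χ-⊕ α x y) ⟩
  sgn (a ∧ b) * sgn (a ∧ c) * (χ α x * χ α y)
    ≡⟨ solve 4 (λ p q r s → p :* q :* (r :* s) := p :* r :* (q :* s)) refl (sgn (a ∧ b)) (sgn (a ∧ c)) (χ α x) (χ α y) ⟩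
  sgn (a ∧ b) * χ α x * (sgn (a ∧ c) * χ α y)  ≡⟨ sym (cong₂ _*_ (χ-cons a b α x) (χ-cons a c α y)) ⟩
  χ (a ∷ α) (b ∷ x) * χ (a ∷ α) (c ∷ y)        ∎
  where
  coordinate : ∀ a → sgn (a ∧ (b xor c)) ≡ sgn (a ∧ b) * sgn (a ∧ c)
  coordinate true = sgn-xor b c
  coordinate false = refl


-- The kernel K(x, t) = Σ_α χ_α(x) χ_α(t); it is 2^n times the indicator of x = t.
K : ∀ n → BV n → BV n → ℚ
K n x t = sumL (allBV n) (λ α → χ α x * χ α t)

K-suc : ∀ n c d (x t : BV n) → K (suc n) (c ∷ x) (d ∷ t) ≡ (sgn c * sgn d + 1ℚ) * K n x t
K-suc n c d x t = begin
  K (suc n) (c ∷ x) (d ∷ t)  ≡⟨ sum-suc n _ ⟩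
  sumL (allBV n) (λ α → χ (true ∷ α) (c ∷ x) * χ (true ∷ α) (d ∷ t)) + K n x t
    ≡⟨ cong (_+ K n x t) (sum-cong (allBV n) (λ α →
         trans (cong₂ _*_ (χ-cons true c α x) (χ-cons true d α t))
           (solve 4 (λ c d p q → c :* p :* (d :* q) := c :* d :* (p :* q)) refl (sgn c) (sgn d) (χ α x) (χ α t)))) ⟩
  sumL (allBV n) (λ α → sgn c * sgn d * (χ α x * χ α t)) + K n x t
    ≡⟨ cong (_+ K n x t) (sum-*ˡ (allBV n) (sgn c * sgn d) _) ⟩
  sgn c * sgn d * K n x t + K n x t
    ≡⟨ solve 2 (λ a k → a :* k :+ k := (a :+ con 1ℚ) :* k) refl (sgn c * sgn d) (K n x t) ⟩
  (sgn c * sgn d + 1ℚ) * K n x t ∎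

E-kernel : ∀ n (g : BV n → ℚ) (t : BV n) → 𝔼 n (λ x → g x * K n x t) ≡ g t
E-kernel zero g [] = solve 1 (λ a → con 1ℚ :* (a :* (con 1ℚ :* con 1ℚ :+ con 0ℚ) :+ con 0ℚ) := a) refl (g [])
E-kernel (suc n) g (d ∷ t) = begin
  𝔼 (suc n) (λ x → g x * K (suc n) x (d ∷ t))  ≡⟨ E-suc n _ ⟩
  ½ * (𝔼 n (λ x → g (true ∷ x) * K (suc n) (true ∷ x) (d ∷ t))
       + 𝔼 n (λ x → g (false ∷ x) * K (suc n) (false ∷ x) (d ∷ t)))
    ≡⟨ cong (½ *_) (cong₂ _+_ (half true) (half false)) ⟩
  ½ * (agreement true * g (true ∷ t) + agreement false * g (false ∷ t))  ≡⟨ select d ⟩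
  g (d ∷ t) ∎
  where
  -- 2 if the first coordinates agree, 0 otherwise.
  agreement : Bool → ℚ
  agreement c = sgn c * sgn d + 1ℚ
  half : ∀ c → 𝔼 n (λ x → g (c ∷ x) * K (suc n) (c ∷ x) (d ∷ t)) ≡ agreement c * g (c ∷ t)
  half c = begin
    𝔼 n (λ x → g (c ∷ x) * K (suc n) (c ∷ x) (d ∷ t))
      ≡⟨ E-cong n (λ x → trans (cong (g (c ∷ x) *_) (K-suc n c d x t))
           (solve 3 (λ a w k → a :* (w :* k) := w :* (a :* k)) refl (g (c ∷ x)) (agreement c) (K n x t))) ⟩
    𝔼 n (λ x → agreement c * (g (c ∷ x) * K n x t))  ≡⟨ E-*ˡ n (agreement c) _ ⟩
    agreement c * 𝔼 n (λ x → g (c ∷ x) * K n x t)    ≡⟨ cong (agreement c *_) (E-kernel n (λ x → g (c ∷ x)) t) ⟩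
    agreement c * g (c ∷ t) ∎
  select : ∀ d → ½ * ((sgn true * sgn d + 1ℚ) * g (true ∷ t) + (sgn false * sgn d + 1ℚ) * g (false ∷ t)) ≡ g (d ∷ t)
  select true = solve 2 (λ a b → con ½ :* (con (sgn true * sgn true + 1ℚ) :* a :+ con (sgn false * sgn true + 1ℚ) :* b) := a)
    refl (g (true ∷ t)) (g (false ∷ t))
  select false = solve 2 (λ a b → con ½ :* (con (sgn true * sgn false + 1ℚ) :* a :+ con (sgn false * sgn false + 1ℚ) :* b) := b)
    refl (g (true ∷ t)) (g (false ∷ t))

fourier-inversion : ∀ n (f : BV n → ℚ) (t : BV n) → sumL (allBV n) (λ α → fhat f α * χ α t) ≡ f t
fourier-inversion n f t = begin
  sumL (allBV n) (λ α → fhat f α * χ α t)         ≡⟨ sum-cong (allBV n) (λ α → sym (E-*ʳ n (χ α t) _)) ⟩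
  sumL (allBV n) (λ α → 𝔼 n (λ x → f x * χ α x * χ α t))  ≡⟨ sym (E-sum n (allBV n) _) ⟩
  𝔼 n (λ x → sumL (allBV n) (λ α → f x * χ α x * χ α t))
    ≡⟨ E-cong n (λ x → trans (sum-cong (allBV n) (λ α →
         solve 3 (λ a p q → a :* p :* q := a :* (p :* q)) refl (f x) (χ α x) (χ α t))) (sum-*ˡ (allBV n) (f x) _)) ⟩
  𝔼 n (λ x → f x * K n x t)  ≡⟨ E-kernel n f t ⟩
  f t ∎


disjointInd : ∀ {n} → BV n → BV n → ℚ
disjointInd [] [] = 1ℚ
disjointInd (a ∷ α) (b ∷ u) = if a ∧ b then 0ℚ else disjointInd α u

E-masked-χ : ∀ n (α u : BV n) → 𝔼 n (λ z → χ α (u ⊓ z)) ≡ disjointInd α u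
E-masked-χ zero [] [] = refl
E-masked-χ (suc n) (false ∷ α) (b ∷ u) =
  trans (E-suc n _) (trans (cong (λ e → ½ * (e + e)) (E-masked-χ n α u)) (½-double _))
E-masked-χ (suc n) (true ∷ α) (false ∷ u) =
  trans (E-suc n _) (trans (cong (λ e → ½ * (e + e)) (E-masked-χ n α u)) (½-double _))
E-masked-χ (suc n) (true ∷ α) (true ∷ u) = begin
  𝔼 (suc n) (λ z → χ (true ∷ α) ((true ∷ u) ⊓ z))  ≡⟨ E-suc n _ ⟩
  ½ * (𝔼 n (λ z → sgn (not (dotParity α (u ⊓ z)))) + e)
    ≡⟨ cong (λ q → ½ * (q + e)) (trans (E-cong n (λ z → sgn-not (dotParity α (u ⊓ z)))) (E-neg n _)) ⟩
  ½ * (- e + e)  ≡⟨ solve 1 (λ c → con ½ :* (:- c :+ c) := con 0ℚ) refl e ⟩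
  0ℚ ∎
  where e = 𝔼 n (λ z → χ α (u ⊓ z))

E-disjointInd : ∀ n (α : BV n) → 𝔼 n (disjointInd α) ≡ ½ ^ℚ weight α
E-disjointInd zero [] = refl
E-disjointInd (suc n) (false ∷ α) =
  trans (E-suc n _) (trans (cong (λ e → ½ * (e + e)) (E-disjointInd n α)) (½-double _))
E-disjointInd (suc n) (true ∷ α) = trans (E-suc n _)
  (trans (cong₂ (λ e e′ → ½ * (e + e′)) (E-const n 0ℚ) (E-disjointInd n α))
  (solve 1 (λ c → con ½ :* (con 0ℚ :+ c) := con ½ :* c) refl (½ ^ℚ weight α)))

subsetCharSum : ∀ {n} → BV n → BV n → ℚ
subsetCharSum {n} α y = sumL (allBV n) (λ β → if subsetB β α then χ β y else 0ℚ)

sum-if-neg : ∀ {A : Set} (as : List A) (s : A → Bool) (g : A → ℚ)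
  → sumL as (λ a → if s a then - g a else 0ℚ) ≡ - sumL as (λ a → if s a then g a else 0ℚ)
sum-if-neg [] s g = refl
sum-if-neg (a ∷ as) s g = trans (cong ((if s a then - g a else 0ℚ) +_) (sum-if-neg as s g)) (lemma (s a))
  where
  rest = sumL as (λ a → if s a then g a else 0ℚ)
  lemma : ∀ b → (if b then - g a else 0ℚ) + - rest ≡ - ((if b then g a else 0ℚ) + rest)
  lemma true = solve 2 (λ p r → :- p :+ :- r := :- (p :+ r)) refl (g a) rest
  lemma false = solve 1 (λ r → con 0ℚ :+ :- r := :- (con 0ℚ :+ r)) refl rest

subsetCharSum-disjoint : ∀ n (α y : BV n) → ½ ^ℚ weight α * subsetCharSum α y ≡ disjointInd α y
subsetCharSum-disjoint zero [] [] = solve 0 (con 1ℚ :* (con 1ℚ :+ con 0ℚ) := con 1ℚ) refl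
subsetCharSum-disjoint (suc n) (false ∷ α) (d ∷ y) = begin
  ½ ^ℚ weight α * subsetCharSum (false ∷ α) (d ∷ y)  ≡⟨ cong (½ ^ℚ weight α *_) (sum-suc n _) ⟩
  ½ ^ℚ weight α * (sumL (allBV n) (λ _ → 0ℚ) + subsetCharSum α y)
    ≡⟨ cong (λ q → ½ ^ℚ weight α * (q + subsetCharSum α y)) (sum-0 (allBV n)) ⟩
  ½ ^ℚ weight α * (0ℚ + subsetCharSum α y)  ≡⟨ cong (½ ^ℚ weight α *_) (+-identityˡ (subsetCharSum α y)) ⟩
  ½ ^ℚ weight α * subsetCharSum α y  ≡⟨ subsetCharSum-disjoint n α y ⟩
  disjointInd α y ∎
subsetCharSum-disjoint (suc n) (true ∷ α) (false ∷ y) = begin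
  ½ * ½ ^ℚ weight α * subsetCharSum (true ∷ α) (false ∷ y)  ≡⟨ cong (½ * ½ ^ℚ weight α *_) (sum-suc n _) ⟩
  ½ * ½ ^ℚ weight α * (subsetCharSum α y + subsetCharSum α y)
    ≡⟨ solve 2 (λ h s → con ½ :* h :* (s :+ s) := h :* s) refl (½ ^ℚ weight α) _ ⟩
  ½ ^ℚ weight α * subsetCharSum α y  ≡⟨ subsetCharSum-disjoint n α y ⟩
  disjointInd α y ∎
subsetCharSum-disjoint (suc n) (true ∷ α) (true ∷ y) = begin
  ½ * ½ ^ℚ weight α * subsetCharSum (true ∷ α) (true ∷ y)  ≡⟨ cong (½ * ½ ^ℚ weight α *_) (sum-suc n _) ⟩
  ½ * ½ ^ℚ weight α * (flipped + S)
    ≡⟨ cong (λ q → ½ * ½ ^ℚ weight α * (q + S)) (trans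
         (sum-cong (allBV n) (λ β → cong (λ q → if subsetB β α then q else 0ℚ) (sgn-not (dotParity β y))))
         (sum-if-neg (allBV n) (λ β → subsetB β α) (λ β → χ β y))) ⟩
  ½ * ½ ^ℚ weight α * (- S + S)  ≡⟨ solve 2 (λ h s → con ½ :* h :* (:- s :+ s) := con 0ℚ) refl (½ ^ℚ weight α) S ⟩
  0ℚ ∎
  where
  S = subsetCharSum α y
  flipped = sumL (allBV n) (λ β → if subsetB β α then sgn (not (dotParity β y)) else 0ℚ)

subsetSum-disjoint : ∀ n (f : BV n → ℚ) (α : BV n)
  → ½ ^ℚ weight α * subsetSum f α ≡ 𝔼 n (λ y → f y * disjointInd α y)
subsetSum-disjoint n f α = begin
  ½ ^ℚ weight α * subsetSum f α
    ≡⟨ cong (½ ^ℚ weight α *_) (sum-cong (allBV n) (λ β → E-if n (subsetB β α) _)) ⟩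
  ½ ^ℚ weight α * sumL (allBV n) (λ β → 𝔼 n (λ y → if subsetB β α then f y * χ β y else 0ℚ))
    ≡⟨ cong (½ ^ℚ weight α *_) (sym (E-sum n (allBV n) _)) ⟩
  ½ ^ℚ weight α * 𝔼 n (λ y → sumL (allBV n) (λ β → if subsetB β α then f y * χ β y else 0ℚ))
    ≡⟨ cong (½ ^ℚ weight α *_) (E-cong n (λ y →
         trans (sum-cong (allBV n) (λ β → factor (subsetB β α) (f y) (χ β y))) (sum-*ˡ (allBV n) (f y) _))) ⟩
  ½ ^ℚ weight α * 𝔼 n (λ y → f y * subsetCharSum α y)  ≡⟨ sym (E-*ˡ n (½ ^ℚ weight α) (λ y → f y * subsetCharSum α y)) ⟩
  𝔼 n (λ y → ½ ^ℚ weight α * (f y * subsetCharSum α y))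
    ≡⟨ E-cong n (λ y → trans
         (solve 3 (λ h a s → h :* (a :* s) := a :* (h :* s)) refl (½ ^ℚ weight α) (f y) (subsetCharSum α y))
         (cong (f y *_) (subsetCharSum-disjoint n α y))) ⟩
  𝔼 n (λ y → f y * disjointInd α y) ∎
  where
  factor : ∀ b a q → (if b then a * q else 0ℚ) ≡ a * (if b then q else 0ℚ)
  factor true a q = refl
  factor false a q = solve 1 (λ a → con 0ℚ := a :* con 0ℚ) refl a


PM : ℚ → Set
PM a = (a ≡ 1ℚ) ⊎ (a ≡ - 1ℚ)

indEq-pm : ∀ a b → PM a → PM b → indEq a b ≡ ½ + ½ * (a * b)
indEq-pm _ _ (inj₁ refl) (inj₁ refl) = refl
indEq-pm _ _ (inj₁ refl) (inj₂ refl) = refl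
indEq-pm _ _ (inj₂ refl) (inj₁ refl) = refl
indEq-pm _ _ (inj₂ refl) (inj₂ refl) = refl

mul-pm : ∀ a b → PM a → PM b → PM (a * b)
mul-pm _ _ (inj₁ refl) (inj₁ refl) = inj₁ refl
mul-pm _ _ (inj₁ refl) (inj₂ refl) = inj₂ refl
mul-pm _ _ (inj₂ refl) (inj₁ refl) = inj₂ refl
mul-pm _ _ (inj₂ refl) (inj₂ refl) = inj₁ refl


mask : ∀ {n} → (BV n → ℚ) → BV n → BV n → BV n
mask {n} f y z = (scal n (vBit (f y)) ⊕ y) ⊓ z

⊕-𝟏-involutive : ∀ {n} (y : BV n) → 𝟏 n ⊕ (𝟏 n ⊕ y) ≡ y
⊕-𝟏-involutive [] = refl
⊕-𝟏-involutive (b ∷ y) = cong₂ _∷_ (not-involutive b) (⊕-𝟏-involutive y)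

scal-false : ∀ {n} (y : BV n) → scal n false ⊕ y ≡ y
scal-false [] = refl
scal-false (b ∷ y) = cong (b ∷_) (scal-false y)

shift-by-vBit : ∀ {n} (φ : BV n → ℚ) (y : BV n) (s : ℚ) → PM s
  → φ (scal n (vBit s) ⊕ y) ≡ ½ * (1ℚ + s) * φ y + ½ * (1ℚ + - s) * φ (𝟏 n ⊕ y)
shift-by-vBit {n} φ y _ (inj₁ refl) = trans (cong φ (scal-false y))
  (solve 2 (λ a b → a := con ½ :* (con 1ℚ :+ con 1ℚ) :* a :+ con ½ :* (con 1ℚ :+ :- con 1ℚ) :* b) refl (φ y) (φ (𝟏 n ⊕ y)))
shift-by-vBit φ y _ (inj₂ refl) =
  solve 2 (λ a b → b := con ½ :* (con 1ℚ :+ :- con 1ℚ) :* a :+ con ½ :* (con 1ℚ :+ :- (:- con 1ℚ)) :* b) refl (φ y) _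

-- For odd f, the substitution y ↦ 𝟏 + y exchanges the events f(y) = ±1.
E-odd-reflect : ∀ n (f : BV n → ℚ) → (∀ x → f (𝟏 n ⊕ x) ≡ - f x) → (φ : BV n → ℚ)
  → 𝔼 n (λ y → ½ * (1ℚ + - f y) * φ (𝟏 n ⊕ y)) ≡ 𝔼 n (λ y → ½ * (1ℚ + f y) * φ y)
E-odd-reflect n f odd φ = trans (sym (E-translate n (𝟏 n) _)) (E-cong n reflect)
  where
  reflect : ∀ y → ½ * (1ℚ + - f (𝟏 n ⊕ y)) * φ (𝟏 n ⊕ (𝟏 n ⊕ y)) ≡ ½ * (1ℚ + f y) * φ y
  reflect y rewrite odd y | ⊕-𝟏-involutive y =
    cong (λ q → ½ * (1ℚ + q) * φ y) (solve 1 (λ a → :- (:- a) := a) refl (f y))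

E-mask-χ : ∀ n (f : BV n → ℚ) → IsBoolean f → (∀ x → f (𝟏 n ⊕ x) ≡ - f x) → ∀ α
  → 𝔼 n (λ y → 𝔼 n (λ z → χ α (mask f y z))) ≡ ½ ^ℚ weight α * (1ℚ + subsetSum f α)
E-mask-χ n f boolean odd α = begin
  𝔼 n (λ y → 𝔼 n (λ z → χ α (mask f y z)))
    ≡⟨ E-cong n (λ y → trans (E-masked-χ n α _) (shift-by-vBit D y (f y) (boolean y))) ⟩
  𝔼 n (λ y → ½ * (1ℚ + f y) * D y + ½ * (1ℚ + - f y) * D (𝟏 n ⊕ y))
    ≡⟨ E-+ n _ _ ⟩
  𝔼 n (λ y → ½ * (1ℚ + f y) * D y) + 𝔼 n (λ y → ½ * (1ℚ + - f y) * D (𝟏 n ⊕ y))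
    ≡⟨ cong (𝔼 n (λ y → ½ * (1ℚ + f y) * D y) +_) (E-odd-reflect n f odd D) ⟩
  𝔼 n (λ y → ½ * (1ℚ + f y) * D y) + 𝔼 n (λ y → ½ * (1ℚ + f y) * D y)
    ≡⟨ sym (E-+ n _ _) ⟩
  𝔼 n (λ y → ½ * (1ℚ + f y) * D y + ½ * (1ℚ + f y) * D y)
    ≡⟨ E-cong n (λ y → solve 2 (λ a d → con ½ :* (con 1ℚ :+ a) :* d :+ con ½ :* (con 1ℚ :+ a) :* d := d :+ a :* d) refl (f y) (D y)) ⟩
  𝔼 n (λ y → D y + f y * D y)  ≡⟨ E-+ n _ _ ⟩
  𝔼 n D + 𝔼 n (λ y → f y * D y)  ≡⟨ cong₂ _+_ (E-disjointInd n α) (sym (subsetSum-disjoint n f α)) ⟩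
  ½ ^ℚ weight α + ½ ^ℚ weight α * subsetSum f α
    ≡⟨ solve 2 (λ h s → h :+ h :* s := h :* (con 1ℚ :+ s)) refl (½ ^ℚ weight α) (subsetSum f α) ⟩
  ½ ^ℚ weight α * (1ℚ + subsetSum f α) ∎
  where
  D : BV n → ℚ
  D = disjointInd α


-- The α-th term of the expansion of f(x_i) f(x_j) f(x_i + x_j + w).
fourierTerm : ∀ {n} → (BV n → ℚ) → BV n → BV n → BV n → BV n → BV n → ℚ
fourierTerm f α xi xj y z = fhat f α * (f xi * χ α xi) * (f xj * χ α xj) * χ α (mask f y z)

basicAccept-fourier : ∀ n (f : BV n → ℚ) → IsBoolean f → ∀ xi xj y z
  → basicAccept f xi xj y z ≡ ½ + ½ * sumL (allBV n) (λ α → fourierTerm f α xi xj y z)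
basicAccept-fourier n f boolean xi xj y z =
  trans (indEq-pm (f xi * f xj) (f t) (mul-pm (f xi) (f xj) (boolean xi) (boolean xj)) (boolean t))
    (cong (λ q → ½ + ½ * q) (begin
      f xi * f xj * f t  ≡⟨ cong (f xi * f xj *_) (sym (fourier-inversion n f t)) ⟩
      f xi * f xj * sumL (allBV n) (λ α → fhat f α * χ α t)  ≡⟨ sym (sum-*ˡ (allBV n) (f xi * f xj) _) ⟩
      sumL (allBV n) (λ α → f xi * f xj * (fhat f α * χ α t))
        ≡⟨ sum-cong (allBV n) (λ α → trans
             (cong (λ q → f xi * f xj * (fhat f α * q))
               (trans (χ-⊕ α (xi ⊕ xj) w) (cong (_* χ α w) (χ-⊕ α xi xj))))
             (solve 6 (λ a b h p q r → a :* b :* (h :* (p :* q :* r)) := h :* (a :* p) :* (b :* q) :* r) refl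
               (f xi) (f xj) (fhat f α) (χ α xi) (χ α xj) (χ α w))) ⟩
      sumL (allBV n) (λ α → fourierTerm f α xi xj y z) ∎))
  where
  w = mask f y z
  t = (xi ⊕ xj) ⊕ w

E-fourierTerm : ∀ n (f : BV n → ℚ) → IsBoolean f → (∀ x → f (𝟏 n ⊕ x) ≡ - f x) → ∀ α
  → 𝔼⁴ n (fourierTerm f α) ≡ (fhat f α * fhat f α * fhat f α) * (½ ^ℚ weight α) * (1ℚ + subsetSum f α)
E-fourierTerm n f boolean odd α = begin
  𝔼⁴ n (fourierTerm f α)  ≡⟨ 𝔼⁴-product n (fhat f α) (λ x → f x * χ α x) (λ x → f x * χ α x) (λ y z → χ α (mask f y z)) ⟩
  a * a * a * 𝔼 n (λ y → 𝔼 n (λ z → χ α (mask f y z)))  ≡⟨ cong (a * a * a *_) (E-mask-χ n f boolean odd α) ⟩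
  a * a * a * (½ ^ℚ weight α * (1ℚ + subsetSum f α))
    ≡⟨ solve 3 (λ c h s → c :* (h :* s) := c :* h :* s) refl (a * a * a) (½ ^ℚ weight α) _ ⟩
  (a * a * a) * (½ ^ℚ weight α) * (1ℚ + subsetSum f α) ∎
  where a = fhat f α


mainTheorem3 : (n : ℕ) (f : BV n → ℚ) → IsBoolean f
    → (∀ x → f (𝟏 n ⊕ x) ≡ - f x)
    → basicTestAcc f
    ≡ ½ + ½ * sumL (allBV n) (λ α →
    (fhat f α * fhat f α * fhat f α) * (½ ^ℚ weight α)
    * (1ℚ + subsetSum f α))
mainTheorem3 n f boolean odd = begin
  basicTestAcc f
    ≡⟨ 𝔼⁴-cong n (basicAccept-fourier n f boolean) ⟩
  𝔼⁴ n (λ xi xj y z → ½ + ½ * sumL (allBV n) (λ α → fourierTerm f α xi xj y z))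
    ≡⟨ 𝔼⁴-affine n _ ⟩
  ½ + ½ * 𝔼⁴ n (λ xi xj y z → sumL (allBV n) (λ α → fourierTerm f α xi xj y z))
    ≡⟨ cong (λ q → ½ + ½ * q) (𝔼⁴-sum n (allBV n) (fourierTerm f)) ⟩
  ½ + ½ * sumL (allBV n) (λ α → 𝔼⁴ n (fourierTerm f α))
    ≡⟨ cong (λ q → ½ + ½ * q) (sum-cong (allBV n) (E-fourierTerm n f boolean odd)) ⟩
  ½ + ½ * sumL (allBV n) (λ α → (fhat f α * fhat f α * fhat f α) * (½ ^ℚ weight α) * (1ℚ + subsetSum f α)) ∎
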